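{- If $n$ is a composite positive integer and $p$ is the smallest prime divisor of $n$, then $T(n)<1+T(n-1)+\left(2\lfloor\sqrt{n}\rfloor-2\right)T\!\left(\frac{n}{p}-1\right)$.
   Context: For a vector $A=(a_1,\ldots,a_k)$, $k\geq 1$, of positive integers define $f(A)$ recursively by $f(a_1)=a_1$ and $f(a_1,\ldots,a_{i+1})=(f(a_1,\ldots,a_i)+1)\,a_{i+1}$. For a positive integer $n$, $T(n)$ is the number of vectors $A$ (of any length $k\geq1$, with positive integer entries) such that $f(A)=n$; also $T(0):=1$. -}

module Defs where

open import Data.Nat using (ℕ; zero; suc; _+_; _*_; _≤_; _<_)
open import Data.List using (List; []; _∷_; length)
open import Data.List.Relation.Unary.All using (All)
open import Data.List.Relation.Unary.Unique.Propositional using (Unique)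
open import Data.List.Membership.Propositional using (_∈_)
open import Data.Product using (Σ; _×_)
open import Data.Empty using (⊥)
open import Function.Bundles using (_⇔_)
open import Relation.Binary.PropositionalEquality using (_≡_)

-- A vector A = (a₁,…,aₖ) of positive integers is represented as a
-- list of naturals (all entries ≥ 1, k ≥ 1 enforced in `Valid`).
-- fAcc acc (a ∷ as) processes entries left to right:
--   f(a₁) = a₁,  f(a₁,…,a_{i+1}) = (f(a₁,…,a_i) + 1) * a_{i+1}.
fAcc : ℕ → List ℕ → ℕ
fAcc acc []       = acc
fAcc acc (a ∷ as) = fAcc ((acc + 1) * a) as

-- f is only meaningful on nonempty lists.
f : List ℕ → ℕ
f []       = 0
f (a ∷ as) = fAcc a as

Valid : List ℕ → Set
Valid []       = ⊥
Valid (a ∷ as) = All (λ x → 1 ≤ x) (a ∷ as)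

-- "T(n) = c" for positive n: c is the number of valid vectors A with f(A) = n,
-- witnessed by a duplicate-free list enumerating exactly those vectors.
-- For n = 0 the convention T(0) = 1 is used.
IsT : ℕ → ℕ → Set
IsT zero    c = c ≡ 1
IsT (suc m) c = Σ (List (List ℕ)) λ L →
  Unique L × (∀ A → (A ∈ L) ⇔ (Valid A × f A ≡ suc m)) × length L ≡ c

IsFloorSqrt : ℕ → ℕ → Set
IsFloorSqrt n s = s * s ≤ n × n < suc s * suc s

module Submission where

-- Let n = p·q be composite with least prime divisor p, and s = ⌊√n⌋.
-- Every vector A with f(A) = n ends in some entry a, A = B ∷ʳ a, and then
-- n = (f(B) + 1)·a.  Three cases occur:
--   * B = [], so A = (n);
--   * a = 1, so f(B) = n − 1 and B is counted by T(n − 1);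
--   * a ≥ 2 and e = f(B) + 1 ≥ 2, so (a, e) is a pair of divisors ≥ p, hence
--     e ≤ q, and padding B with q − e ones yields a vector counted by T(q − 1).
-- Since e·a < (s+1)², a ≤ s or e ≤ s, and the pair (a, e) is determined by
-- one of these two numbers; this indexes the pairs by 2s − 2 numbers.
-- So A ↦ (its case, index, B or padded B) is an injection into a list of
-- length 1 + T(n−1) + (2s−2)·T(q−1), and it misses the element
-- (index for e = p, vector (q − 1)): hitting it would force a = q > s ≥ p,
-- i.e. a nonempty padding of a nonempty B.  Only the upper bound
-- n < (s+1)² on s is needed.

open import Defs
open import Data.Nat using (ℕ; _+_; _*_; _∸_; _<_; _≤_)
open import Data.Nat.Divisibility using (_∣_)
open import Data.Nat.Primality using (Prime; Composite)
open import Relation.Binary.PropositionalEquality using (_≡_)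

open import Data.Nat.Base using (zero; suc; z≤n; s≤s; NonZero; >-nonZero; nonTrivial⇒n>1)
open import Data.Nat.Properties
open import Data.Nat.Divisibility using (divides; ∣-trans; ∣⇒≤; m∣m*n)
open import Data.Nat.Primality using (prime⇒nonTrivial; composite⇒nonTrivial; composite⇒¬prime)
open import Data.Nat.Primality.Factorisation using (factorise)
open import Data.Nat.ListAction using (product)
open import Data.List.Base
  using (List; []; _∷_; [_]; _++_; _∷ʳ_; length; map; replicate; upTo; cartesianProductWith; InitLast; _∷ʳ′_; initLast)
open import Data.List.Properties using (∷-injectiveʳ; length-++; length-map; length-upTo; length-removeAt′; ++-cancelʳ; ++-conicalʳ)
open import Data.List.Relation.Unary.All as All using (All; []; _∷_)
import Data.List.Relation.Unary.All.Properties as Allₚ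
open import Data.List.Relation.Unary.Any using (here; there; _─_; index)
open import Data.List.Relation.Unary.Unique.Propositional using (Unique)
open import Data.List.Relation.Unary.AllPairs using (_∷_)
open import Data.List.Membership.Propositional using (_∈_)
open import Data.List.Membership.Propositional.Properties
  using (∈-map⁺; ∈-++⁺ˡ; ∈-++⁺ʳ; ∈-upTo⁺; ∈-cartesianProductWith⁺)
open import Data.Product using (∃-syntax; _×_; _,_)
open import Data.Sum using (_⊎_; inj₁; inj₂; reduce)
open import Function.Bundles using (_⇔_; Equivalence)
open import Relation.Binary.PropositionalEquality using (_≢_; refl; sym; trans; cong; cong₂; subst; module ≡-Reasoning)
open import Relation.Nullary using (yes; no; contradiction)

open Equivalence using (to; from)

module _ {X : Set} where

  ∈-─ : ∀ {x y} {ys : List X} (x∈ys : x ∈ ys) → y ∈ ys → y ≢ x → y ∈ (ys ─ x∈ys)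
  ∈-─ (here refl) (here refl)  y≢x = contradiction refl y≢x
  ∈-─ (here _)    (there y∈ys) _   = y∈ys
  ∈-─ (there _)   (here refl)  _   = here refl
  ∈-─ (there x∈ys) (there y∈ys) y≢x = there (∈-─ x∈ys y∈ys y≢x)

module _ {X Y : Set} (h : X → Y) where

  injection-length≤ : ∀ {L M} → Unique L → (∀ {x} → x ∈ L → h x ∈ M) →
    (∀ {x y} → x ∈ L → y ∈ L → h x ≡ h y → x ≡ y) → length L ≤ length M
  injection-length≤ {[]}    _           _    _   = z≤n
  injection-length≤ {x ∷ L} {M} (x∉L ∷ uL) into inj = begin
      suc (length L)          ≤⟨ s≤s (injection-length≤ uL into′ (λ y∈ z∈ → inj (there y∈) (there z∈))) ⟩
      suc (length (M ─ hx∈M)) ≡⟨ sym (length-removeAt′ M (index hx∈M)) ⟩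
      length M                ∎
    where
    open ≤-Reasoning
    hx∈M : h x ∈ M
    hx∈M = into (here refl)
    into′ : ∀ {y} → y ∈ L → h y ∈ (M ─ hx∈M)
    into′ y∈L = ∈-─ hx∈M (into (there y∈L))
      (λ hy≡hx → All.lookup x∉L y∈L (sym (inj (there y∈L) (here refl) hy≡hx)))

  injection-length< : ∀ {L M y₀} → Unique L → (∀ {x} → x ∈ L → h x ∈ M) →
    (∀ {x y} → x ∈ L → y ∈ L → h x ≡ h y → x ≡ y) →
    y₀ ∈ M → (∀ {x} → x ∈ L → h x ≢ y₀) → length L < length M
  injection-length< {L} {M} uL into inj y₀∈M missed = begin-strict
      length L                 <⟨ s≤s (injection-length≤ uL (λ x∈L → ∈-─ y₀∈M (into x∈L) (missed x∈L)) inj) ⟩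
      suc (length (M ─ y₀∈M))  ≡⟨ sym (length-removeAt′ M (index y₀∈M)) ⟩
      length M                 ∎
    where open ≤-Reasoning

length-cartesianProductWith : ∀ {A B C : Set} (g : A → B → C) xs ys →
  length (cartesianProductWith g xs ys) ≡ length xs * length ys
length-cartesianProductWith g []       ys = refl
length-cartesianProductWith g (x ∷ xs) ys = begin
    length (map (g x) ys ++ cartesianProductWith g xs ys)  ≡⟨ length-++ (map (g x) ys) ⟩
    length (map (g x) ys) + length (cartesianProductWith g xs ys)
      ≡⟨ cong₂ _+_ (length-map (g x) ys) (length-cartesianProductWith g xs ys) ⟩
    length ys + length xs * length ys                       ∎
  where open ≡-Reasoning

fAcc-++ : ∀ acc xs ys → fAcc acc (xs ++ ys) ≡ fAcc (fAcc acc xs) ys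
fAcc-++ acc []       ys = refl
fAcc-++ acc (x ∷ xs) ys = fAcc-++ ((acc + 1) * x) xs ys

-- The defining recursion read at the last entry: f(B ∷ʳ a) = (f(B) + 1)·a.
-- It holds for B = [] as well, because f [] = 0.
f-∷ʳ : ∀ B a → f (B ∷ʳ a) ≡ (f B + 1) * a
f-∷ʳ []       a = sym (+-identityʳ a)
f-∷ʳ (b ∷ bs) a = fAcc-++ b bs [ a ]

fAcc-ones : ∀ acc k → fAcc acc (replicate k 1) ≡ acc + k
fAcc-ones acc zero    = sym (+-identityʳ acc)
fAcc-ones acc (suc k) = begin
    fAcc ((acc + 1) * 1) (replicate k 1) ≡⟨ fAcc-ones ((acc + 1) * 1) k ⟩
    (acc + 1) * 1 + k                    ≡⟨ cong (_+ k) (*-identityʳ (acc + 1)) ⟩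
    acc + 1 + k                          ≡⟨ +-assoc acc 1 k ⟩
    acc + suc k                          ∎
  where open ≡-Reasoning

f-ones : ∀ b bs k → f ((b ∷ bs) ++ replicate k 1) ≡ f (b ∷ bs) + k
f-ones b bs k = trans (fAcc-++ b bs (replicate k 1)) (fAcc-ones (fAcc b bs) k)

fAcc-≥ : ∀ acc xs → All (1 ≤_) xs → acc ≤ fAcc acc xs
fAcc-≥ acc []       []          = ≤-refl
fAcc-≥ acc (x ∷ xs) (1≤x ∷ 1≤xs) = begin
    acc            ≤⟨ m≤m+n acc 1 ⟩
    acc + 1        ≤⟨ m≤m*n (acc + 1) x {{>-nonZero 1≤x}} ⟩
    (acc + 1) * x  ≤⟨ fAcc-≥ ((acc + 1) * x) xs 1≤xs ⟩
    fAcc ((acc + 1) * x) xs ∎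
  where open ≤-Reasoning

cofactor-≥2 : ∀ {b bs} → All (1 ≤_) (b ∷ bs) → 2 ≤ f (b ∷ bs) + 1
cofactor-≥2 {b} {bs} (1≤b ∷ 1≤bs) = +-monoˡ-≤ 1 (≤-trans 1≤b (fAcc-≥ b bs 1≤bs))

-- Padding arithmetic: raising f from m to n − 1 takes n − (m + 1) ones.
m+[n∸1+m]≡n∸1 : ∀ m {n} → suc m ≤ n → m + (n ∸ suc m) ≡ n ∸ 1
m+[n∸1+m]≡n∸1 m (s≤s m≤n) = m+[n∸m]≡n m≤n

ones≢[] : ∀ {k} → 0 < k → replicate k 1 ≢ []
ones≢[] {suc k} _ ()

≥2⇒nonZero : ∀ {d} → 2 ≤ d → NonZero d
≥2⇒nonZero 2≤d = >-nonZero (≤-trans (s≤s z≤n) 2≤d)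

factor-≤-root : ∀ {e a s} → e * a < suc s * suc s → e ≤ s ⊎ a ≤ s
factor-≤-root {e} {a} {s} ea< with e ≤? s | a ≤? s
... | yes e≤s | _        = inj₁ e≤s
... | no _    | yes a≤s  = inj₂ a≤s
... | no e≰s  | no a≰s   = contradiction (*-mono-≤ (≰⇒> e≰s) (≰⇒> a≰s)) (<⇒≱ ea<)

-- A pair of divisors a, e ≥ 2 of n < (s+1)² is indexed by a − 2 ∈ [0, s−1)
-- when a ≤ s, and otherwise by s − 1 + (e − 2) ∈ [s−1, 2s−2).
pairIndex : ℕ → ℕ → ℕ → ℕ
pairIndex s a e with a ≤? s
... | yes _ = a ∸ 2
... | no  _ = s ∸ 1 + (e ∸ 2)

∸2<∸1 : ∀ {d s} → 2 ≤ d → d ≤ s → d ∸ 2 < s ∸ 1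
∸2<∸1 {suc (suc _)} {suc _} (s≤s (s≤s _)) (s≤s d≤s) = d≤s

lower<upper : ∀ {a s} → 2 ≤ a → a ≤ s → ∀ k → a ∸ 2 < s ∸ 1 + k
lower<upper 2≤a a≤s k = <-≤-trans (∸2<∸1 2≤a a≤s) (m≤m+n _ k)

upper<2s-2 : ∀ {d s} → 2 ≤ d → d ≤ s → s ∸ 1 + (d ∸ 2) < 2 * s ∸ 2
upper<2s-2 {d} {s} 2≤d d≤s = begin-strict
    s ∸ 1 + (d ∸ 2)   <⟨ +-monoʳ-< (s ∸ 1) (∸2<∸1 2≤d d≤s) ⟩
    s ∸ 1 + (s ∸ 1)   ≡⟨ cong (s ∸ 1 +_) (sym (+-identityʳ (s ∸ 1))) ⟩
    2 * (s ∸ 1)       ≡⟨ *-distribˡ-∸ 2 s 1 ⟩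
    2 * s ∸ 2         ∎
  where open ≤-Reasoning

-- All indices lie in [0, 2s − 2): if a > s then e ≤ s by factor-≤-root.
pairIndex-< : ∀ {a e s} → 2 ≤ a → 2 ≤ e → e * a < suc s * suc s → pairIndex s a e < 2 * s ∸ 2
pairIndex-< {a} {e} {s} 2≤a 2≤e ea< with a ≤? s
... | yes a≤s = <-≤-trans (lower<upper 2≤a a≤s (a ∸ 2)) (<⇒≤ (upper<2s-2 2≤a a≤s))
... | no  a≰s with factor-≤-root ea<
...   | inj₁ e≤s = upper<2s-2 2≤e e≤s
...   | inj₂ a≤s = contradiction a≤s a≰s

pairIndex-lower : ∀ {a e d s} → 2 ≤ a → 2 ≤ d → d ≤ s → pairIndex s a e ≡ d ∸ 2 → a ≡ d
pairIndex-lower {a} {e} {d} {s} 2≤a 2≤d d≤s idx≡ with a ≤? s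
... | yes _ = ∸-cancelʳ-≡ 2≤a 2≤d idx≡
... | no  _ = contradiction (sym idx≡) (<⇒≢ (lower<upper 2≤d d≤s (e ∸ 2)))

pairIndex-upper : ∀ {a e d s} → 2 ≤ a → 2 ≤ e → 2 ≤ d →
  pairIndex s a e ≡ s ∸ 1 + (d ∸ 2) → s < a × e ≡ d
pairIndex-upper {a} {e} {d} {s} 2≤a 2≤e 2≤d idx≡ with a ≤? s
... | yes a≤s = contradiction idx≡ (<⇒≢ (lower<upper 2≤a a≤s (d ∸ 2)))
... | no  a≰s = ≰⇒> a≰s , ∸-cancelʳ-≡ 2≤e 2≤d (+-cancelˡ-≡ (s ∸ 1) _ _ idx≡)

pairIndex-injective : ∀ {a e a′ e′ s} → 2 ≤ a → 2 ≤ e → 2 ≤ a′ → 2 ≤ e′ →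
  e * a ≡ e′ * a′ → pairIndex s a e ≡ pairIndex s a′ e′ → a ≡ a′ × e ≡ e′
pairIndex-injective {a} {e} {a′} {e′} {s} 2≤a 2≤e 2≤a′ 2≤e′ ea≡ idx≡ with a′ ≤? s
... | yes a′≤s = a≡a′ , *-cancelʳ-≡ e e′ a {{≥2⇒nonZero 2≤a}} (trans ea≡ (cong (e′ *_) (sym a≡a′)))
  where a≡a′ = pairIndex-lower 2≤a 2≤a′ a′≤s idx≡
... | no  _ with pairIndex-upper 2≤a 2≤e 2≤e′ idx≡
...   | _ , e≡e′ = *-cancelˡ-≡ a a′ e {{≥2⇒nonZero 2≤e}} (trans ea≡ (cong (_* a′) (sym e≡e′))) , e≡e′

prime-divisor : ∀ {d} → 2 ≤ d → ∃[ r ] Prime r × r ∣ d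
prime-divisor {suc (suc d₀)} (s≤s (s≤s _)) with factorise (suc (suc d₀))
... | record { factors = [] ; isFactorisation = () }
... | record { factors = r ∷ rs ; isFactorisation = d≡ ; factorsPrime = r-prime ∷ _ } =
  r , r-prime , subst (r ∣_) (sym d≡) (m∣m*n (product rs))

least-prime-divisor-≤ : ∀ {n p} → (∀ r → Prime r → r ∣ n → p ≤ r) →
  ∀ {d} → 2 ≤ d → d ∣ n → p ≤ d
least-prime-divisor-≤ p-least 2≤d d∣n with prime-divisor 2≤d
... | r , r-prime , r∣d =
  ≤-trans (p-least r r-prime (∣-trans r∣d d∣n)) (∣⇒≤ {{≥2⇒nonZero 2≤d}} r∣d)

-- How a vector counted by T(n) ends: as the single entry n, with a last
-- entry 1, or with a last entry a ≥ 2 combined with a padded prefix.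
data Shape : Set where
  single   : Shape
  unitTail : List ℕ → Shape
  pairTail : ℕ → List ℕ → Shape

pairTail-injective : ∀ {i i′ C C′} → pairTail i C ≡ pairTail i′ C′ → i ≡ i′ × C ≡ C′
pairTail-injective refl = refl , refl

module ShapeCount
  (n p q s : ℕ) (Ln Lq : List (List ℕ))
  (2≤p : 2 ≤ p) (2≤q : 2 ≤ q) (n≡pq : n ≡ p * q)
  (p-least : ∀ {d} → 2 ≤ d → d ∣ n → p ≤ d)
  (n<[1+s]² : n < suc s * suc s)
  (Ln-spec : ∀ A → (A ∈ Ln) ⇔ (Valid A × f A ≡ n ∸ 1))
  (Lq-spec : ∀ A → (A ∈ Lq) ⇔ (Valid A × f A ≡ q ∸ 1))
  where

  -- n ≥ 2·2, so no vector counted by T(n) ends in 0.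
  n≢0 : n ≢ 0
  n≢0 n≡0 with subst (4 ≤_) (trans (sym n≡pq) n≡0) (*-mono-≤ 2≤p 2≤q)
  ... | ()

  -- p ≤ q since q ≥ 2 divides n; hence p² ≤ n < (s+1)², i.e. p ≤ s.
  p≤s : p ≤ s
  p≤s = reduce (factor-≤-root (≤-<-trans p²≤n n<[1+s]²))
    where
    p²≤n : p * p ≤ n
    p²≤n = subst (p * p ≤_) (sym n≡pq) (*-monoʳ-≤ p (p-least 2≤q (divides p n≡pq)))

  -- In a factorisation n = e·a with a ≥ 2 we have a ≥ p, so e ≤ n / p = q.
  cofactor-≤ : ∀ {e a} → 2 ≤ a → e * a ≡ n → e ≤ q
  cofactor-≤ {e} {a} 2≤a ea≡n = *-cancelˡ-≤ p {{≥2⇒nonZero 2≤p}} (begin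
      p * e  ≤⟨ *-monoˡ-≤ e (p-least 2≤a (divides e (sym ea≡n))) ⟩
      a * e  ≡⟨ *-comm a e ⟩
      e * a  ≡⟨ trans ea≡n n≡pq ⟩
      p * q  ∎)
    where open ≤-Reasoning

  data LastStep : List ℕ → ℕ → Set where
    alone   : LastStep [] n
    unit    : ∀ {b bs} → (b ∷ bs) ∈ Ln → LastStep (b ∷ bs) 1
    divisor : ∀ {b bs a} → All (1 ≤_) (b ∷ bs) → (f (b ∷ bs) + 1) * (2 + a) ≡ n →
              LastStep (b ∷ bs) (2 + a)

  lastStep : ∀ B a → Valid (B ∷ʳ a) → f (B ∷ʳ a) ≡ n → LastStep B a
  lastStep []       a _ a≡n = subst (LastStep []) (sym a≡n) alone
  lastStep (b ∷ bs) zero _ fA≡n =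
    contradiction (trans (sym fA≡n) (trans (f-∷ʳ (b ∷ bs) 0) (*-zeroʳ (f (b ∷ bs) + 1)))) n≢0
  lastStep (b ∷ bs) 1 valid fA≡n =
    unit (from (Ln-spec (b ∷ bs)) (Allₚ.++⁻ˡ (b ∷ bs) valid , fB≡n∸1))
    where
    open ≡-Reasoning
    fB≡n∸1 : f (b ∷ bs) ≡ n ∸ 1
    fB≡n∸1 = begin
      f (b ∷ bs)               ≡⟨ sym (m+n∸n≡m (f (b ∷ bs)) 1) ⟩
      f (b ∷ bs) + 1 ∸ 1       ≡⟨ cong (_∸ 1) (sym (*-identityʳ (f (b ∷ bs) + 1))) ⟩
      (f (b ∷ bs) + 1) * 1 ∸ 1 ≡⟨ cong (_∸ 1) (trans (sym (f-∷ʳ (b ∷ bs) 1)) fA≡n) ⟩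
      n ∸ 1                    ∎
  lastStep (b ∷ bs) (suc (suc a)) valid fA≡n =
    divisor (Allₚ.++⁻ˡ (b ∷ bs) valid) (trans (sym (f-∷ʳ (b ∷ bs) (2 + a))) fA≡n)

  -- Padding B (with f(B) = e − 1) by ones up to f = q − 1.
  pad : List ℕ → List ℕ
  pad B = B ++ replicate (q ∸ (f B + 1)) 1

  code : List ℕ → ℕ → Shape
  code []          _ = single
  code B@(_ ∷ _)   1 = unitTail B
  code B           a = pairTail (pairIndex s a (f B + 1)) (pad B)

  shapes : List Shape
  shapes = single ∷ map unitTail Ln ++ cartesianProductWith pairTail (upTo (2 * s ∸ 2)) Lq

  length-shapes : length shapes ≡ 1 + length Ln + (2 * s ∸ 2) * length Lq
  length-shapes = cong suc (begin
      length (map unitTail Ln ++ cartesianProductWith pairTail (upTo (2 * s ∸ 2)) Lq)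
        ≡⟨ length-++ (map unitTail Ln) ⟩
      length (map unitTail Ln) + length (cartesianProductWith pairTail (upTo (2 * s ∸ 2)) Lq)
        ≡⟨ cong₂ _+_ (length-map unitTail Ln) (length-cartesianProductWith pairTail (upTo (2 * s ∸ 2)) Lq) ⟩
      length Ln + length (upTo (2 * s ∸ 2)) * length Lq
        ≡⟨ cong (λ k → length Ln + k * length Lq) (length-upTo (2 * s ∸ 2)) ⟩
      length Ln + (2 * s ∸ 2) * length Lq ∎)
    where open ≡-Reasoning

  -- The padded prefix is counted by T(q − 1), since f(B) + 1 ≤ q.
  pad-∈ : ∀ {b bs a} → All (1 ≤_) (b ∷ bs) → (f (b ∷ bs) + 1) * (2 + a) ≡ n → pad (b ∷ bs) ∈ Lq
  pad-∈ {b} {bs} valid ea≡n =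
    from (Lq-spec _) (Allₚ.++⁺ valid (Allₚ.replicate⁺ _ (s≤s z≤n)) , f-pad)
    where
    open ≡-Reasoning
    e≤q : suc (f (b ∷ bs)) ≤ q
    e≤q = subst (_≤ q) (+-comm (f (b ∷ bs)) 1) (cofactor-≤ (s≤s (s≤s z≤n)) ea≡n)
    f-pad : f (pad (b ∷ bs)) ≡ q ∸ 1
    f-pad = begin
      f (pad (b ∷ bs))                   ≡⟨ f-ones b bs _ ⟩
      f (b ∷ bs) + (q ∸ (f (b ∷ bs) + 1)) ≡⟨ cong (λ k → f (b ∷ bs) + (q ∸ k)) (+-comm (f (b ∷ bs)) 1) ⟩
      f (b ∷ bs) + (q ∸ suc (f (b ∷ bs))) ≡⟨ m+[n∸1+m]≡n∸1 (f (b ∷ bs)) e≤q ⟩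
      q ∸ 1                               ∎

  code-∈ : ∀ {B a} → LastStep B a → code B a ∈ shapes
  code-∈ alone           = here refl
  code-∈ (unit B∈Ln)     = there (∈-++⁺ˡ (∈-map⁺ unitTail B∈Ln))
  code-∈ (divisor valid ea≡n) = there (∈-++⁺ʳ (map unitTail Ln)
    (∈-cartesianProductWith⁺ pairTail (∈-upTo⁺ index<) (pad-∈ valid ea≡n)))
    where
    index< = pairIndex-< {s = s} (s≤s (s≤s z≤n)) (cofactor-≥2 valid)
               (subst (_< suc s * suc s) (sym ea≡n) n<[1+s]²)

  -- Distinct vectors get distinct shapes: the index recovers (a, f(B) + 1),
  -- hence the padding length, and stripping the padding recovers B.
  code-injective : ∀ {B a B′ a′} → LastStep B a → LastStep B′ a′ →
    code B a ≡ code B′ a′ → B ≡ B′ × a ≡ a′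
  code-injective alone    alone    _    = refl , refl
  code-injective (unit _) (unit _) refl = refl , refl
  code-injective {b ∷ bs} {_} {b′ ∷ bs′} (divisor v ea≡n) (divisor v′ ea≡n′) eq
    with pairTail-injective eq
  ... | index≡ , pad≡
    with pairIndex-injective {s = s} (s≤s (s≤s z≤n)) (cofactor-≥2 v) (s≤s (s≤s z≤n)) (cofactor-≥2 v′)
           (trans ea≡n (sym ea≡n′)) index≡
  ... | a≡a′ , e≡e′ = ++-cancelʳ _ (b ∷ bs) (b′ ∷ bs′)
          (trans pad≡ (cong (λ e → (b′ ∷ bs′) ++ replicate (q ∸ e) 1) (sym e≡e′))) , a≡a′
  code-injective alone        (unit _)      ()
  code-injective alone        (divisor _ _) ()
  code-injective (unit _)     alone         ()
  code-injective (unit _)     (divisor _ _) ()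
  code-injective (divisor _ _) alone        ()
  code-injective (divisor _ _) (unit _)     ()

  -- The shape for e = p with the vector (q − 1): it would need a = q > s ≥ p,
  -- so a nonempty prefix followed by q − p ≥ 1 padding ones, not (q − 1).
  missed : Shape
  missed = pairTail (s ∸ 1 + (p ∸ 2)) [ q ∸ 1 ]

  missed-∈ : missed ∈ shapes
  missed-∈ = there (∈-++⁺ʳ (map unitTail Ln)
    (∈-cartesianProductWith⁺ pairTail (∈-upTo⁺ (upper<2s-2 2≤p p≤s))
      (from (Lq-spec [ q ∸ 1 ]) ((m<n⇒0<n∸m 2≤q ∷ []) , refl))))

  code-misses : ∀ {B a} → LastStep B a → code B a ≢ missed
  code-misses alone    ()
  code-misses (unit _) ()
  code-misses {b ∷ bs} {suc (suc a)} (divisor v ea≡n) eq with pairTail-injective eq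
  ... | index≡ , pad≡ with pairIndex-upper {s = s} (s≤s (s≤s z≤n)) (cofactor-≥2 v) 2≤p index≡
  ... | s<a , e≡p = padding-nonempty (++-conicalʳ bs _ (∷-injectiveʳ pad≡))
    where
    a≡q : 2 + a ≡ q
    a≡q = *-cancelˡ-≡ (2 + a) q p {{≥2⇒nonZero 2≤p}}
      (trans (cong (_* (2 + a)) (sym e≡p)) (trans ea≡n n≡pq))
    p<q : p < q
    p<q = ≤-<-trans p≤s (subst (s <_) a≡q s<a)
    padding-nonempty : replicate (q ∸ (f (b ∷ bs) + 1)) 1 ≢ []
    padding-nonempty = subst (λ e → replicate (q ∸ e) 1 ≢ []) (sym e≡p) (ones≢[] (m<n⇒0<n∸m p<q))

  encodeView : {A : List ℕ} → InitLast A → Shape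
  encodeView []         = single
  encodeView (B ∷ʳ′ a)  = code B a

  encode : List ℕ → Shape
  encode A = encodeView (initLast A)

  Counted : List ℕ → Set
  Counted A = Valid A × f A ≡ n

  encodeView-∈ : {A : List ℕ} (v : InitLast A) → Counted A → encodeView v ∈ shapes
  encodeView-∈ (B ∷ʳ′ a) (valid , fA≡n) = code-∈ (lastStep B a valid fA≡n)

  encodeView-misses : {A : List ℕ} (v : InitLast A) → Counted A → encodeView v ≢ missed
  encodeView-misses (B ∷ʳ′ a) (valid , fA≡n) = code-misses (lastStep B a valid fA≡n)

  encodeView-injective : {A A′ : List ℕ} (v : InitLast A) (v′ : InitLast A′) →
    Counted A → Counted A′ → encodeView v ≡ encodeView v′ → A ≡ A′
  encodeView-injective (B ∷ʳ′ a) (B′ ∷ʳ′ a′) (valid , fA≡n) (valid′ , fA′≡n) eq =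
    let B≡B′ , a≡a′ = code-injective (lastStep B a valid fA≡n) (lastStep B′ a′ valid′ fA′≡n) eq
    in  cong₂ _∷ʳ_ B≡B′ a≡a′

  T-bound : ∀ L → Unique L → (∀ A → (A ∈ L) ⇔ Counted A) →
    length L < 1 + length Ln + (2 * s ∸ 2) * length Lq
  T-bound L unique-L L-spec = subst (length L <_) length-shapes
    (injection-length< encode unique-L
      (λ {A} A∈L → encodeView-∈ (initLast A) (counted A∈L))
      (λ {A} {A′} A∈L A′∈L → encodeView-injective (initLast A) (initLast A′) (counted A∈L) (counted A′∈L))
      missed-∈
      (λ {A} A∈L → encodeView-misses (initLast A) (counted A∈L)))
    where
    counted : ∀ {A} → A ∈ L → Counted A
    counted {A} = to (L-spec A)

IsT⇒enumeration : ∀ {m c} → 1 ≤ m → IsT m c →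
  ∃[ L ] Unique L × (∀ A → (A ∈ L) ⇔ (Valid A × f A ≡ m)) × length L ≡ c
IsT⇒enumeration {suc _} _ T = T

prime-≥2 : ∀ {p} → Prime p → 2 ≤ p
prime-≥2 {p} p-prime = nonTrivial⇒n>1 p {{prime⇒nonTrivial p-prime}}

composite-cofactor-≥2 : ∀ {n p q} → 1 ≤ n → Composite n → Prime p → n ≡ p * q → 2 ≤ q
composite-cofactor-≥2 {p = p} {q = zero} 1≤n _ _ n≡pq
  with subst (1 ≤_) (trans n≡pq (*-zeroʳ p)) 1≤n
... | ()
composite-cofactor-≥2 {p = p} {q = suc zero} _ composite p-prime n≡pq =
  contradiction (subst Prime (sym (trans n≡pq (*-identityʳ p))) p-prime) (composite⇒¬prime composite)
composite-cofactor-≥2 {q = suc (suc _)} _ _ _ _ = s≤s (s≤s z≤n)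

corollary3 : (n p q s t tn tq : ℕ) → 1 ≤ n → Composite n →
    Prime p → p ∣ n → (∀ r → Prime r → r ∣ n → p ≤ r) →
    n ≡ p * q → IsFloorSqrt n s →
    IsT n t → IsT (n ∸ 1) tn → IsT (q ∸ 1) tq →
    t < 1 + tn + (2 * s ∸ 2) * tq
corollary3 n p q s t tn tq 1≤n composite p-prime _ p-least n≡pq (_ , n<[1+s]²) Tn Tn∸1 Tq∸1
  with IsT⇒enumeration 1≤n Tn
     | IsT⇒enumeration (m<n⇒0<n∸m (nonTrivial⇒n>1 n {{composite⇒nonTrivial composite}})) Tn∸1
     | IsT⇒enumeration (m<n⇒0<n∸m (composite-cofactor-≥2 1≤n composite p-prime n≡pq)) Tq∸1
... | L , unique-L , L-spec , refl | Ln , _ , Ln-spec , refl | Lq , _ , Lq-spec , refl =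
  ShapeCount.T-bound n p q s Ln Lq (prime-≥2 p-prime) (composite-cofactor-≥2 1≤n composite p-prime n≡pq)
    n≡pq (least-prime-divisor-≤ p-least) n<[1+s]² Ln-spec Lq-spec L unique-L L-spec
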